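{- There exists a coupling $(X_t,Y_t)_{t\ge0}$ of the Glauber dynamics for $\mu_{\mathcal{T},p}$ with the Glauber dynamics for $\mu_p$ such that if $X_0$ is a subgraph of $Y_0$, then $X_t$ is a subgraph of $Y_t$ for all $t\ge0$.
   Context: Graphs are on $[n]$. $\mu_p$ is the law of $G(n,p)$; its Glauber dynamics at each step chooses a uniformly random pair $e\in\binom{[n]}2$ and includes it with probability $p$, excludes it with probability $1-p$. $\mu_{\mathcal{T},p}$ is $G(n,p)$ conditioned on triangle-freeness; its Glauber dynamics at each step chooses a uniformly random pair $e\in\binom{[n]}2$ and resamples it from its conditional law given the other pairs: it is included with probability $p$ if this creates no triangle (probability $0$ otherwise), and excluded otherwise.
   Formalization: The edge probability p of $\mu_p$ and $\mu_{\mathcal{T},p}$ takes rational values in [0,1]. -}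

module Defs where

open import Data.Bool using (Bool; true; false; _∧_; _xor_; not; if_then_else_)
open import Data.Nat using (ℕ; zero; suc; _<ᵇ_)
open import Data.Fin using (Fin; toℕ)
import Data.Fin as Fin
open import Data.Integer using (+_)
open import Data.Rational using (ℚ; 0ℚ; 1ℚ; _+_; _*_; _-_; _/_; _≤_; _<_)
open import Data.List using (List; []; _∷_; map; concatMap; allFin; length; foldr)
open import Data.Bool.ListAction using (all; any)
open import Data.List.Membership.Propositional using (_∈_)
open import Data.Product using (Σ; _×_; _,_; proj₁; proj₂)
open import Data.Empty using (⊥)
open import Relation.Binary.PropositionalEquality using (_≡_)
open import Relation.Nullary.Decidable using (⌊_⌋)

-- A graph on [n] is encoded by a Boolean table; only the entries (i , j)
-- with i < j are meaningful (the edge {i,j}).  Adjacency is read via adj.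
Graph : ℕ → Set
Graph n = Fin n → Fin n → Bool

adj : ∀ {n} → Graph n → Fin n → Fin n → Bool
adj x i j = if toℕ i <ᵇ toℕ j then x i j
            else (if toℕ j <ᵇ toℕ i then x j i else false)

pairs : (n : ℕ) → List (Fin n × Fin n)
pairs n = concatMap (λ i → concatMap (λ j → if toℕ i <ᵇ toℕ j then (i , j) ∷ [] else [])
                                      (allFin n))
                    (allFin n)

eqG : ∀ {n} → Graph n → Graph n → Bool
eqG {n} x y = all (λ i → all (λ j → not (adj x i j xor adj y i j)) (allFin n)) (allFin n)

_⊆G_ : ∀ {n} → Graph n → Graph n → Set
x ⊆G y = ∀ i j → adj x i j ≡ true → adj y i j ≡ true

TriangleFree : ∀ {n} → Graph n → Set
TriangleFree x = ∀ i j k → adj x i j ≡ true → adj x j k ≡ true → adj x i k ≡ true → ⊥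

setE : ∀ {n} → Graph n → Fin n × Fin n → Bool → Graph n
setE x (i , j) b a c = if ⌊ a Fin.≟ i ⌋ ∧ ⌊ c Fin.≟ j ⌋ then b else x a c

createsTri : ∀ {n} → Graph n → Fin n × Fin n → Bool
createsTri {n} x (i , j) = any (λ k → adj x i k ∧ adj x k j) (allFin n)

Dist : Set → Set
Dist A = List (ℚ × A)

mass : ∀ {A : Set} → Dist A → (A → Bool) → ℚ
mass D f = foldr (λ { (w , a) s → if f a then w + s else s }) 0ℚ D

-- 1/N with the convention 1/0 = 0 (only relevant when n < 2, no pairs)
inv : ℕ → ℚ
inv zero = 0ℚ
inv (suc k) = (+ 1) / suc k

glauberP : ∀ {n} → ℚ → Graph n → Dist (Graph n)
glauberP {n} p y =
  concatMap (λ e → (inv (length (pairs n)) * p , setE y e true)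
                 ∷ (inv (length (pairs n)) * (1ℚ - p) , setE y e false) ∷ [])
            (pairs n)

glauberT : ∀ {n} → ℚ → Graph n → Dist (Graph n)
glauberT {n} p x =
  concatMap (λ e → if createsTri x e
                   then (inv (length (pairs n)) , setE x e false) ∷ []
                   else ((inv (length (pairs n)) * p , setE x e true)
                        ∷ (inv (length (pairs n)) * (1ℚ - p) , setE x e false) ∷ []))
            (pairs n)

fstD : ∀ {A B : Set} → Dist (A × B) → Dist A
fstD = map (λ { (w , (a , b)) → (w , a) })

sndD : ∀ {A B : Set} → Dist (A × B) → Dist B
sndD = map (λ { (w , (a , b)) → (w , b) })

Kernel : ℕ → Set
Kernel n = Graph n → Graph n → Dist (Graph n × Graph n)

-- K is a (Markovian) coupling of Glauber for μ_{T,p} (state space: triangle-free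
-- graphs) with Glauber for μ_p: nonnegative weights and correct one-step marginals.
IsCoupling : ∀ {n} → ℚ → Kernel n → Set
IsCoupling {n} p K =
  ∀ (x y : Graph n) →
    (∀ w c → (w , c) ∈ K x y → 0ℚ ≤ w)
  × (TriangleFree x → ∀ z → mass (fstD (K x y)) (eqG z) ≡ mass (glauberT p x) (eqG z))
  × (∀ z → mass (sndD (K x y)) (eqG z) ≡ mass (glauberP p y) (eqG z))

evolve : ∀ {n} → Kernel n → ℕ → Graph n → Graph n → Dist (Graph n × Graph n)
evolve K zero x y = (1ℚ , (x , y)) ∷ []
evolve K (suc t) x y =
  concatMap (λ { (w , (a , b)) → map (λ { (v , c) → (w * v , c) }) (K a b) })
            (evolve K t x y)

{-# OPTIONS --safe #-}
module Submission where

-- Both chains pick the same pair e and toss the same p-coin. The μ_p chain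
-- includes e iff the coin succeeds; the triangle-free chain includes e iff the
-- coin succeeds and e closes no triangle. So the first chain never holds an edge
-- the second lacks. When e closes a triangle both coin outcomes exclude e, and
-- their weights N⁻¹ p and N⁻¹ (1 - p) merge into the weight N⁻¹ of the
-- conditioned Glauber step.

open import Defs
open import Data.Bool using (Bool; true; false; not; if_then_else_; _∧_)
open import Data.Fin using (Fin; toℕ; _≟_)
open import Data.List using ([]; _∷_; _++_; length; concatMap)
open import Data.List.Properties using (map-concatMap)
open import Data.List.Membership.Propositional using (_∈_)
open import Data.List.Relation.Unary.All as All using (All; []; _∷_)
open import Data.List.Relation.Unary.All.Properties using (concat⁺; map⁺)
open import Data.Nat using (ℕ; zero; suc; _<ᵇ_)
open import Data.Product using (Σ; _×_; _,_; proj₁)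
open import Data.Rational using (ℚ; 0ℚ; 1ℚ; _≤_; _<_; _+_; _*_; _-_; -_)
import Data.Rational.Properties as ℚ
open import Data.Rational.Solver using (module +-*-Solver)
open import Function using (_∘_; id)
open import Relation.Nullary.Decidable using (⌊_⌋)
open import Relation.Binary.PropositionalEquality
  using (_≡_; refl; sym; trans; cong; cong₂; subst; module ≡-Reasoning)

*-nonNeg : ∀ {a b} → 0ℚ ≤ a → 0ℚ ≤ b → 0ℚ ≤ a * b
*-nonNeg {a} {b} 0≤a 0≤b =
  subst (_≤ a * b) (ℚ.*-zeroʳ a)
        (ℚ.*-monoˡ-≤-nonNeg a {{Data.Rational.nonNegative 0≤a}} 0≤b)

inv-nonNeg : ∀ k → 0ℚ ≤ inv k
inv-nonNeg zero    = ℚ.≤-refl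
inv-nonNeg (suc k) = ℚ.nonNegative⁻¹ _ {{ℚ.normalize-nonNeg 1 (suc k)}}

p≤1⇒0≤1-p : ∀ {p} → p ≤ 1ℚ → 0ℚ ≤ 1ℚ - p
p≤1⇒0≤1-p {p} p≤1 = subst (_≤ 1ℚ - p) (ℚ.+-inverseʳ p) (ℚ.+-monoˡ-≤ (- p) p≤1)

*-split : ∀ a p → a * p + a * (1ℚ - p) ≡ a
*-split = solve 2 (λ a p → a :* p :+ a :* (con 1ℚ :- p) := a) refl
  where open +-*-Solver

module _ {A : Set} (f : A → Bool) where

  mass-++ : ∀ (D E : Dist A) → mass (D ++ E) f ≡ mass D f + mass E f
  mass-++ []            E = sym (ℚ.+-identityˡ (mass E f))
  mass-++ ((w , a) ∷ D) E with f a
  ... | true  = trans (cong (w +_) (mass-++ D E))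
                      (sym (ℚ.+-assoc w (mass D f) (mass E f)))
  ... | false = mass-++ D E

  mass-concatMap-cong : ∀ {B : Set} {F G : B → Dist A} →
                        (∀ e → mass (F e) f ≡ mass (G e) f) →
                        ∀ l → mass (concatMap F l) f ≡ mass (concatMap G l) f
  mass-concatMap-cong                 F≈G []      = refl
  mass-concatMap-cong {F = F} {G = G} F≈G (e ∷ l) = begin
    mass (F e ++ concatMap F l) f         ≡⟨ mass-++ (F e) (concatMap F l) ⟩
    mass (F e) f + mass (concatMap F l) f ≡⟨ cong₂ _+_ (F≈G e) (mass-concatMap-cong F≈G l) ⟩
    mass (G e) f + mass (concatMap G l) f ≡⟨ sym (mass-++ (G e) (concatMap G l)) ⟩
    mass (G e ++ concatMap G l) f         ∎
    where open ≡-Reasoning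

  mass-merge : ∀ u v a (D : Dist A) →
               mass ((u , a) ∷ (v , a) ∷ D) f ≡ mass ((u + v , a) ∷ D) f
  mass-merge u v a D with f a
  ... | true  = sym (ℚ.+-assoc u v (mass D f))
  ... | false = refl

-- _⊆G_ reads each pair through adj; setE is easier to handle on the raw
-- entries above the diagonal, which are the only ones adj consults.
_⊆ᵘ_ : ∀ {n} → Graph n → Graph n → Set
_⊆ᵘ_ {n} x y =
  ∀ (a c : Fin n) → (toℕ a <ᵇ toℕ c) ≡ true → x a c ≡ true → y a c ≡ true

⊆G⇒⊆ᵘ : ∀ {n} {x y : Graph n} → x ⊆G y → x ⊆ᵘ y
⊆G⇒⊆ᵘ x⊆y a c a<c with x⊆y a c
... | adj⊆ rewrite a<c = adj⊆

⊆ᵘ⇒⊆G : ∀ {n} {x y : Graph n} → x ⊆ᵘ y → x ⊆G y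
⊆ᵘ⇒⊆G x⊆y a c with toℕ a <ᵇ toℕ c in a<c
... | true = x⊆y a c a<c
... | false with toℕ c <ᵇ toℕ a in c<a
...   | true  = x⊆y c a c<a
...   | false = id

setE-⊆G : ∀ {n} {x y : Graph n} e {b b′} → x ⊆G y → (b ≡ true → b′ ≡ true) →
          setE x e b ⊆G setE y e b′
setE-⊆G {x = x} {y} (i , j) {b} {b′} x⊆y b⇒b′ = ⊆ᵘ⇒⊆G ⊆ᵘ
  where
  ⊆ᵘ : setE x (i , j) b ⊆ᵘ setE y (i , j) b′
  ⊆ᵘ a c a<c with ⌊ a ≟ i ⌋ ∧ ⌊ c ≟ j ⌋
  ... | true  = b⇒b′
  ... | false = ⊆G⇒⊆ᵘ x⊆y a c a<c

evolve-preserves : ∀ {n} (Q : Graph n → Graph n → Set) (K : Kernel n) →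
  (∀ a b → Q a b → All (λ (_ , (a′ , b′)) → Q a′ b′) (K a b)) →
  ∀ {x y} → Q x y → ∀ t → All (λ (_ , (a , b)) → Q a b) (evolve K t x y)
evolve-preserves Q K K-preserves Qxy zero    = Qxy ∷ []
evolve-preserves Q K K-preserves Qxy (suc t) =
  concat⁺ (map⁺ (All.map (λ {(_ , (a , b))} Qab → map⁺ (K-preserves a b Qab))
                         (evolve-preserves Q K K-preserves Qxy t)))

module Coupling {n : ℕ} (p : ℚ) where

  N⁻¹ : ℚ
  N⁻¹ = inv (length (pairs n))

  glauberTStep : Graph n → Fin n × Fin n → Dist (Graph n)
  glauberTStep x e =
    if createsTri x e
    then (N⁻¹ , setE x e false) ∷ []
    else (N⁻¹ * p , setE x e true) ∷ (N⁻¹ * (1ℚ - p) , setE x e false) ∷ []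

  coupledStep : Graph n → Graph n → Fin n × Fin n → Dist (Graph n × Graph n)
  coupledStep x y e = (N⁻¹ * p       , (setE x e (not (createsTri x e)) , setE y e true))
                    ∷ (N⁻¹ * (1ℚ - p) , (setE x e false                  , setE y e false))
                    ∷ []

  coupling : Kernel n
  coupling x y = concatMap (coupledStep x y) (pairs n)

  coupling-nonNeg : 0ℚ ≤ p → p ≤ 1ℚ → ∀ x y → All ((0ℚ ≤_) ∘ proj₁) (coupling x y)
  coupling-nonNeg 0≤p p≤1 x y =
    concat⁺ (map⁺ (All.universal (λ _ → 0≤Np ∷ 0≤N[1-p] ∷ []) (pairs n)))
    where
    0≤Np     = *-nonNeg (inv-nonNeg (length (pairs n))) 0≤p
    0≤N[1-p] = *-nonNeg (inv-nonNeg (length (pairs n))) (p≤1⇒0≤1-p p≤1)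

  fst-coupledStep : ∀ x y (f : Graph n → Bool) e →
                    mass (fstD (coupledStep x y e)) f ≡ mass (glauberTStep x e) f
  fst-coupledStep x y f e with createsTri x e
  ... | false = refl
  ... | true  = trans (mass-merge f (N⁻¹ * p) (N⁻¹ * (1ℚ - p)) (setE x e false) [])
                      (cong (λ w → mass ((w , setE x e false) ∷ []) f) (*-split N⁻¹ p))

  coupling-fst : ∀ x y (f : Graph n → Bool) →
                 mass (fstD (coupling x y)) f ≡ mass (glauberT p x) f
  coupling-fst x y f =
    trans (cong (λ D → mass D f) (map-concatMap _ (coupledStep x y) (pairs n)))
          (mass-concatMap-cong f (fst-coupledStep x y f) (pairs n))

  coupling-snd : ∀ x y → sndD (coupling x y) ≡ glauberP p y
  coupling-snd x y = map-concatMap _ (coupledStep x y) (pairs n)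

  coupling-⊆G : ∀ x y → x ⊆G y → All (λ (_ , (x′ , y′)) → x′ ⊆G y′) (coupling x y)
  coupling-⊆G x y x⊆y = concat⁺ (map⁺ (All.universal step-⊆G (pairs n)))
    where
    step-⊆G : ∀ e → All (λ (_ , (x′ , y′)) → x′ ⊆G y′) (coupledStep x y e)
    step-⊆G e = setE-⊆G e x⊆y (λ _ → refl) ∷ setE-⊆G e x⊆y id ∷ []

open Coupling

lemma3p3 : (n : ℕ) (p : ℚ) → 0ℚ ≤ p → p ≤ 1ℚ →
    Σ (Kernel n) λ K → IsCoupling p K ×
      (∀ (x₀ y₀ : Graph n) → TriangleFree x₀ → x₀ ⊆G y₀ →
        ∀ (t : ℕ) (w : ℚ) (x y : Graph n) →
          (w , (x , y)) ∈ evolve K t x₀ y₀ → 0ℚ < w → x ⊆G y)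
lemma3p3 n p 0≤p p≤1 = coupling p , isCoupling , monotone
  where
  isCoupling : IsCoupling p (coupling p)
  isCoupling x y = (λ _ _ → All.lookup (coupling-nonNeg p 0≤p p≤1 x y))
                 , (λ _ z → coupling-fst p x y (eqG z))
                 , (λ z → cong (λ D → mass D (eqG z)) (coupling-snd p x y))

  monotone : ∀ (x₀ y₀ : Graph n) → TriangleFree x₀ → x₀ ⊆G y₀ →
             ∀ (t : ℕ) (w : ℚ) (x y : Graph n) →
             (w , (x , y)) ∈ evolve (coupling p) t x₀ y₀ → 0ℚ < w → x ⊆G y
  monotone x₀ y₀ _ x₀⊆y₀ t _ _ _ ∈evolve _ =
    All.lookup (evolve-preserves _⊆G_ (coupling p) (coupling-⊆G p) x₀⊆y₀ t) ∈evolve
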